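{- Let $\phi'$ be the map on bilateral Dyck words defined below. For all integers $n\ge 0$ and $k\ge 0$, $\phi'$ restricts to a bijection from the set of bilateral Dyck paths of semilength $n$ with $k$ up-steps at odd height onto the set of bilateral Dyck paths of semilength $n$ with $k$ peaks.
   Context: Paths are lattice paths starting at $(0,0)$ with up-steps $(1,1)$ and down-steps $(1,-1)$, identified with words over $\{U,D\}$. A bilateral Dyck path (word) of semilength $n$ has $n$ up-steps and $n$ down-steps (so it ends on $y=0$). A Dyck path is a bilateral Dyck path with no vertex of negative $y$-coordinate; a negative Dyck path is a bilateral Dyck path of nonzero length with no vertex of positive $y$-coordinate. An up-step from $(i-1,j-1)$ to $(i,j)$ is at height $j$; a down-step from $(i,j)$ to $(i+1,j-1)$ is at height $j$; a step is at odd height if $j$ is odd ($j\in\mathbb{Z}$). A peak is an up-step immediately followed by a down-step. A crossing is either a down-step at height $1$ immediately followed by a down-step at height $0$, or an up-step at height $0$ immediately followed by an up-step at height $1$. Map $\phi$ on Dyck words: $\phi(\epsilon)=\epsilon$; every nonempty Dyck word $W$ is uniquely $W=U\big(\prod_{i=1}^s UW_iD\big)DW_{s+1}$ with $s\ge0$ and $W_i$ Dyck words, and then $\phi(W)=\big(\prod_{i=1}^s U\phi(W_i)\big)UD\,D^s\phi(W_{s+1})$. Map $\alpha$: replaces every $U$ by $D$ and every $D$ by $U$ (reflection in the $x$-axis). Map $\beta$ on nonempty Dyck words: writing $W=UW_1DW_2$ uniquely with $W_1,W_2$ Dyck words, $\beta(W)=UW_2DW_1$. Map $\phi'$: (a)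 if $W$ is a Dyck word, $\phi'(W)=\phi(W)$; (b) if $W$ is a negative Dyck word, $\phi'(W)=\alpha(\phi(\beta(\alpha(W))))$; (c) if the path of $W$ has $l>0$ crossings, write $W$ uniquely as a concatenation $W_1W_2\cdots W_{l+1}$ where the $W_i$ are alternately nonempty Dyck words and negative Dyck words (splitting at the returns to $y=0$ where the path changes side), and set $\phi'(W)=\prod_{i=1}^{l+1}\phi'(W_i)$. -}

module Defs where

open import Data.Bool using (Bool; true; false; if_then_else_)
open import Data.Nat using (ℕ; zero; suc; _+_; _%_)
open import Data.Nat.Properties using (_≟_)
open import Data.Integer as ℤ using (ℤ; ∣_∣)
open import Data.List using (List; []; _∷_; _++_; reverse; replicate; [_]; length)
open import Data.Maybe using (Maybe; just; nothing)
open import Data.Product using (_×_)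
open import Relation.Binary.PropositionalEquality using (_≡_)
open import Relation.Nullary.Decidable using (does)

-- Steps and words (U = up-step (1,1), D = down-step (1,-1))

data Step : Set where
  U D : Step

Word : Set
Word = List Step

countU : Word → ℕ
countU []      = 0
countU (U ∷ w) = suc (countU w)
countU (D ∷ w) = countU w

countD : Word → ℕ
countD []      = 0
countD (U ∷ w) = countD w
countD (D ∷ w) = suc (countD w)

BilateralDyck : ℕ → Word → Set
BilateralDyck n w = (countU w ≡ n) × (countD w ≡ n)

oddℤ : ℤ → Bool
oddℤ j = does (∣ j ∣ % 2 ≟ 1)

-- number of up-steps at odd height, for a path currently at height h.
-- An up-step from (i-1,j-1) to (i,j) is at height j.
oddUpsFrom : ℤ → Word → ℕ
oddUpsFrom h []      = 0
oddUpsFrom h (U ∷ w) =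
  (if oddℤ (h ℤ.+ ℤ.1ℤ) then 1 else 0) + oddUpsFrom (h ℤ.+ ℤ.1ℤ) w
oddUpsFrom h (D ∷ w) = oddUpsFrom (h ℤ.- ℤ.1ℤ) w

oddUps : Word → ℕ
oddUps = oddUpsFrom ℤ.0ℤ

peaks : Word → ℕ
peaks []           = 0
peaks (U ∷ D ∷ w)  = suc (peaks (D ∷ w))
peaks (U ∷ U ∷ w)  = peaks (U ∷ w)
peaks (U ∷ [])     = 0
peaks (D ∷ w)      = peaks w

α : Word → Word
α []      = []
α (U ∷ w) = D ∷ α w
α (D ∷ w) = U ∷ α w

-- Dyck words as plane forests.
-- A Dyck word is uniquely a product of primes U W D; we represent it as
-- a list of trees, node ts standing for the prime U (word of ts) D.

data Tree : Set where
  node : List Tree → Tree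

Forest : Set
Forest = List Tree

mutual
  toWordF : Forest → Word
  toWordF []       = []
  toWordF (t ∷ ts) = toWordT t ++ toWordF ts

  toWordT : Tree → Word
  toWordT (node ts) = U ∷ toWordF ts ++ D ∷ []

-- Stack-based parser: a stack of reversed partial forests.
parseGo : List Forest → Forest → Word → Maybe Forest
parseGo []          cur []      = just (reverse cur)
parseGo (_ ∷ _)     cur []      = nothing
parseGo stk         cur (U ∷ w) = parseGo (cur ∷ stk) [] w
parseGo []          cur (D ∷ w) = nothing
parseGo (up ∷ stk)  cur (D ∷ w) = parseGo stk (node (reverse cur) ∷ up) w

parse : Word → Maybe Forest
parse = parseGo [] []

-- W = U (∏_{i=1}^s U W_i D) D W_{s+1}   corresponds to
--   node (t_1 ∷ … ∷ t_s) ∷ rest with t_i = node (forest of W_i),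
--   rest = forest of W_{s+1};
-- φ(W) = (∏_{i=1}^s U φ(W_i)) U D D^s φ(W_{s+1}).

mutual
  φF : Forest → Word
  φF []              = []
  φF (node ts ∷ rest) = φInner ts ++ (U ∷ D ∷ replicate (length ts) D) ++ φF rest

  φInner : Forest → Word
  φInner []               = []
  φInner (node ws ∷ ts)   = (U ∷ φF ws) ++ φInner ts

-- β on nonempty Dyck words: U W₁ D W₂ ↦ U W₂ D W₁
βF : Forest → Forest
βF []              = []
βF (node c ∷ rest) = node rest ∷ c

-- φ on Dyck words (identity on non-Dyck input, which never occurs below)
φ : Word → Word
φ w with parse w
... | just f  = φF f
... | nothing = w

φneg : Word → Word
φneg w with parse (α w)
... | just f  = α (φF (βF f))
... | nothing = w

-- Splitting a bilateral Dyck word at its returns to y = 0.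
-- primes: maximal factors returning to 0 only at their end.

mutual
  primes : Word → List Word
  primes []      = []
  primes (x ∷ w) = primesGo x 1 (x ∷ []) w

  -- s: first letter of current prime, d: distance from the axis,
  -- acc: reversed current prime
  primesGo : Step → ℕ → Word → Word → List Word
  primesGo s zero    acc w       = reverse acc ∷ primes w
  primesGo s (suc d) acc []      = reverse acc ∷ []
  primesGo U (suc d) acc (U ∷ w) = primesGo U (suc (suc d)) (U ∷ acc) w
  primesGo U (suc d) acc (D ∷ w) = primesGo U d (D ∷ acc) w
  primesGo D (suc d) acc (D ∷ w) = primesGo D (suc (suc d)) (D ∷ acc) w
  primesGo D (suc d) acc (U ∷ w) = primesGo D d (U ∷ acc) w

sameSide : Word → Word → Bool
sameSide (U ∷ _) (U ∷ _) = true
sameSide (D ∷ _) (D ∷ _) = true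
sameSide _       _       = false

-- group consecutive primes lying on the same side of the x-axis:
-- the resulting blocks are W₁, …, W_{l+1} (alternately nonempty Dyck and
-- negative Dyck words), split exactly at the crossings.
groupBlocks : List Word → List Word
groupBlocks []           = []
groupBlocks (p ∷ [])     = p ∷ []
groupBlocks (p ∷ q ∷ ps) with groupBlocks (q ∷ ps)
... | []       = p ∷ []
... | (b ∷ bs) = if sameSide p b then (p ++ b) ∷ bs else p ∷ b ∷ bs

blocks : Word → List Word
blocks w = groupBlocks (primes w)

φ'block : Word → Word
φ'block []        = []
φ'block (U ∷ w)   = φ (U ∷ w)
φ'block (D ∷ w)   = φneg (D ∷ w)

concatMapW : (Word → Word) → List Word → Word
concatMapW f []       = []
concatMapW f (b ∷ bs) = f b ++ concatMapW f bs

φ' : Word → Word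
φ' w = concatMapW φ'block (blocks w)

-- A bilateral Dyck word is cut at its crossings into blocks lying alternately above and below the
-- x-axis; each block is the word of a nonempty plane forest (reflected by α below the axis), and φ'
-- acts blockwise, as φ above the axis and as φ ∘ β below it.  On forests φ is a bijection preserving
-- the number of nodes, so φ' permutes the bilateral Dyck words of each semilength.  By structural
-- recursion, the leaves of φ(F) are the up-steps of F at odd height, and the valleys of φ(β F) are the
-- up-steps at odd height of the reflected word α F.  Peaks of a reflected word are valleys, and every
-- block starts on the axis, so the peaks of φ'(w) are exactly the up-steps of w at odd height.

module Submission where

open import Defs
open import Data.Bool using (Bool; true; false; not; if_then_else_)
open import Data.Bool.Properties using (not-involutive)
open import Data.Empty using (⊥-elim)
open import Data.Integer as ℤ using ()
open import Data.Integer.Properties using ([1+m]⊖[1+n]≡m⊖n)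
  renaming (+-assoc to ℤ-+-assoc; +-identityʳ to ℤ-+-identityʳ)
open import Data.List using (List; []; _∷_; _++_; _∷ʳ_; _ʳ++_; [_]; concat; length; map; replicate; reverse; initLast; _∷ʳ′_)
open import Data.List.NonEmpty as List⁺ using (List⁺; _∷_; _∷⁺_; toList)
open import Data.List.Properties
  using (++-assoc; ++-identityʳ; ++-ʳ++; reverse-involutive; ∷-injective; ∷-injectiveˡ; ∷-injectiveʳ; ∷ʳ-injective)
open import Data.List.Relation.Unary.All using (All; []; _∷_)
open import Data.List.Relation.Unary.All.Properties using (∷ʳ⁻)
open import Data.Maybe using (just)
open import Data.Maybe.Properties using (just-injective)
open import Data.Nat using (ℕ; zero; suc; _+_; _%_; _≤_; s≤s)
open import Data.Nat.Properties
  using (_≟_; +-comm; +-assoc; +-identityʳ; +-suc; suc-injective; ≤-refl; ≤-trans; ≤-reflexive; m≤n⇒m≤1+n)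
open import Data.Nat.Tactic.RingSolver using (solve-∀)
open import Data.Product using (_×_; Σ; ∃; ∃₂; _,_)
open import Data.Sum using (_⊎_; inj₁; inj₂)
open import Data.Vec using (Vec; []; _∷_)
open import Function using (_∘_; _⇔_; mk⇔; Equivalence)
open import Function.Properties.Equivalence using () renaming (trans to ⇔-trans; sym to ⇔-sym)
open import Relation.Binary.PropositionalEquality
  using (_≡_; _≢_; refl; sym; trans; cong; cong₂; module ≡-Reasoning)
open import Relation.Nullary.Decidable using (does)

open ≡-Reasoning

odd-suc : ∀ n → does (suc n % 2 ≟ 1) ≡ not (does (n % 2 ≟ 1))
odd-suc zero          = refl
odd-suc (suc zero)    = refl
odd-suc (suc (suc n)) = odd-suc n

oddℤ-suc : ∀ h → oddℤ (h ℤ.+ ℤ.1ℤ) ≡ not (oddℤ h)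
oddℤ-suc (ℤ.+ n)         rewrite +-comm n 1 = odd-suc n
oddℤ-suc ℤ.-[1+ zero ]    = refl
oddℤ-suc ℤ.-[1+ suc n ]   rewrite [1+m]⊖[1+n]≡m⊖n 0 (suc n) = odd-suc n

oddℤ-pred : ∀ h → oddℤ (h ℤ.- ℤ.1ℤ) ≡ not (oddℤ h)
oddℤ-pred h = begin
  oddℤ (h ℤ.- ℤ.1ℤ)                 ≡⟨ not-involutive _ ⟨
  not (not (oddℤ (h ℤ.- ℤ.1ℤ)))     ≡⟨ cong not (oddℤ-suc (h ℤ.- ℤ.1ℤ)) ⟨
  not (oddℤ (h ℤ.- ℤ.1ℤ ℤ.+ ℤ.1ℤ))  ≡⟨ cong (not ∘ oddℤ) (trans (ℤ-+-assoc h ℤ.-1ℤ ℤ.1ℤ) (ℤ-+-identityʳ h)) ⟩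
  not (oddℤ h)                      ∎

-- up-steps of w at odd height when w starts at a height of parity b (true: odd)
oddUpsᵖ : Bool → Word → ℕ
oddUpsᵖ b []      = 0
oddUpsᵖ b (U ∷ w) = (if not b then 1 else 0) + oddUpsᵖ (not b) w
oddUpsᵖ b (D ∷ w) = oddUpsᵖ (not b) w

oddUpsFrom≡oddUpsᵖ : ∀ h w → oddUpsFrom h w ≡ oddUpsᵖ (oddℤ h) w
oddUpsFrom≡oddUpsᵖ h []      = refl
oddUpsFrom≡oddUpsᵖ h (U ∷ w) rewrite oddUpsFrom≡oddUpsᵖ (h ℤ.+ ℤ.1ℤ) w | oddℤ-suc h = refl
oddUpsFrom≡oddUpsᵖ h (D ∷ w) rewrite oddUpsFrom≡oddUpsᵖ (h ℤ.- ℤ.1ℤ) w | oddℤ-pred h = refl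

α-++ : ∀ x y → α (x ++ y) ≡ α x ++ α y
α-++ []      y = refl
α-++ (U ∷ x) y = cong (D ∷_) (α-++ x y)
α-++ (D ∷ x) y = cong (U ∷_) (α-++ x y)

α-involutive : ∀ x → α (α x) ≡ x
α-involutive []      = refl
α-involutive (U ∷ x) = cong (U ∷_) (α-involutive x)
α-involutive (D ∷ x) = cong (D ∷_) (α-involutive x)

α-injective : ∀ {x y} → α x ≡ α y → x ≡ y
α-injective {x} {y} eq = trans (sym (α-involutive x)) (trans (cong α eq) (α-involutive y))

length-α : ∀ x → length (α x) ≡ length x
length-α []      = refl
length-α (U ∷ x) = cong suc (length-α x)
length-α (D ∷ x) = cong suc (length-α x)

countU-α : ∀ x → countU (α x) ≡ countD x
countU-α []      = refl
countU-α (U ∷ x) = countU-α x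
countU-α (D ∷ x) = cong suc (countU-α x)

countD-α : ∀ x → countD (α x) ≡ countU x
countD-α []      = refl
countD-α (U ∷ x) = cong suc (countD-α x)
countD-α (D ∷ x) = countD-α x

Balanced : Word → Set
Balanced w = countU w ≡ countD w

Balanced-α : ∀ w → Balanced w → Balanced (α w)
Balanced-α w bal = trans (countU-α w) (trans (sym bal) (sym (countD-α w)))

data NoLeadingD : Word → Set where
  []  : NoLeadingD []
  U∷_ : ∀ w → NoLeadingD (U ∷ w)

peaks-U∷ : ∀ {y} → NoLeadingD y → peaks (U ∷ y) ≡ peaks y
peaks-U∷ []       = refl
peaks-U∷ (U∷ _)   = refl

data Side : Set where
  above below : Side

opposite : Side → Side
opposite above = below
opposite below = above

up down : Side → Step
up above   = U
up below   = D
down above = D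
down below = U

onSide : Side → Word → Word
onSide above w = w
onSide below w = α w

onSide-++ : ∀ s x y → onSide s (x ++ y) ≡ onSide s x ++ onSide s y
onSide-++ above x y = refl
onSide-++ below x y = α-++ x y

toWordT-++ : ∀ c w → toWordT (node c) ++ w ≡ U ∷ toWordF c ++ D ∷ w
toWordT-++ c w = cong (U ∷_) (++-assoc (toWordF c) [ D ] w)

toWordF-++ : ∀ f g → toWordF (f ++ g) ≡ toWordF f ++ toWordF g
toWordF-++ []      g = refl
toWordF-++ (t ∷ f) g = trans (cong (toWordT t ++_) (toWordF-++ f g)) (sym (++-assoc (toWordT t) (toWordF f) (toWordF g)))

toWordF-∷ʳ : ∀ f t → toWordF (f ∷ʳ t) ≡ toWordF f ++ toWordT t
toWordF-∷ʳ f t = trans (toWordF-++ f [ t ]) (cong (toWordF f ++_) (++-identityʳ (toWordT t)))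

onSide-toWordT : ∀ s c → onSide s (toWordT (node c)) ≡ up s ∷ onSide s (toWordF c) ++ [ down s ]
onSide-toWordT above c = refl
onSide-toWordT below c = cong (D ∷_) (α-++ (toWordF c) [ D ])

onSide-toWordT-++ : ∀ s c w → onSide s (toWordT (node c)) ++ w ≡ up s ∷ onSide s (toWordF c) ++ down s ∷ w
onSide-toWordT-++ s c w = trans (cong (_++ w) (onSide-toWordT s c)) (cong (up s ∷_) (++-assoc (onSide s (toWordF c)) [ down s ] w))

onSide-toWordF-∷ : ∀ s c f →
  onSide s (toWordF (node c ∷ f)) ≡ up s ∷ onSide s (toWordF c) ++ down s ∷ onSide s (toWordF f)
onSide-toWordF-∷ s c f = trans (onSide-++ s (toWordT (node c)) (toWordF f)) (onSide-toWordT-++ s c (onSide s (toWordF f)))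

onSide-toWordF-∷-++ : ∀ s c f w →
  onSide s (toWordF (node c ∷ f)) ++ w ≡ up s ∷ onSide s (toWordF c) ++ down s ∷ onSide s (toWordF f) ++ w
onSide-toWordF-∷-++ s c f w = begin
  onSide s (toWordF (node c ∷ f)) ++ w
    ≡⟨ cong (_++ w) (onSide-toWordF-∷ s c f) ⟩
  up s ∷ (onSide s (toWordF c) ++ down s ∷ onSide s (toWordF f)) ++ w
    ≡⟨ cong (up s ∷_) (++-assoc (onSide s (toWordF c)) (down s ∷ onSide s (toWordF f)) w) ⟩
  up s ∷ onSide s (toWordF c) ++ down s ∷ onSide s (toWordF f) ++ w ∎

parseGo-U∷ : ∀ stk cur w → parseGo stk cur (U ∷ w) ≡ parseGo (cur ∷ stk) [] w
parseGo-U∷ []      cur w = refl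
parseGo-U∷ (_ ∷ _) cur w = refl

parseGo-toWordF-++ : ∀ stk cur f w → parseGo stk cur (toWordF f ++ w) ≡ parseGo stk (f ʳ++ cur) w
parseGo-toWordF-++ stk cur []           w = refl
parseGo-toWordF-++ stk cur (node c ∷ f) w = begin
  parseGo stk cur (toWordF (node c ∷ f) ++ w)
    ≡⟨ cong (parseGo stk cur) (onSide-toWordF-∷-++ above c f w) ⟩
  parseGo stk cur (U ∷ toWordF c ++ D ∷ toWordF f ++ w)
    ≡⟨ parseGo-U∷ stk cur _ ⟩
  parseGo (cur ∷ stk) [] (toWordF c ++ D ∷ toWordF f ++ w)
    ≡⟨ parseGo-toWordF-++ (cur ∷ stk) [] c _ ⟩
  parseGo stk (node (reverse (reverse c)) ∷ cur) (toWordF f ++ w)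
    ≡⟨ cong (λ c′ → parseGo stk (node c′ ∷ cur) (toWordF f ++ w)) (reverse-involutive c) ⟩
  parseGo stk (node c ∷ cur) (toWordF f ++ w)
    ≡⟨ parseGo-toWordF-++ stk (node c ∷ cur) f w ⟩
  parseGo stk (f ʳ++ node c ∷ cur) w ∎

parse-toWordF : ∀ f → parse (toWordF f) ≡ just f
parse-toWordF f = begin
  parseGo [] [] (toWordF f)       ≡⟨ cong (parseGo [] []) (++-identityʳ (toWordF f)) ⟨
  parseGo [] [] (toWordF f ++ []) ≡⟨ parseGo-toWordF-++ [] [] f [] ⟩
  just (reverse (reverse f))      ≡⟨ cong just (reverse-involutive f) ⟩
  just f                          ∎

toWordF-injective : ∀ {f g} → toWordF f ≡ toWordF g → f ≡ g
toWordF-injective {f} {g} eq = just-injective (trans (sym (parse-toWordF f)) (trans (cong parse eq) (parse-toWordF g)))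

-- The map φ on forests

-- φPrime c is the tree whose word is φ(U W D), for W the word of c.
mutual
  φPrime : Forest → Tree
  φPrime []           = node []
  φPrime (node c ∷ f) = node (φForest c ∷ʳ φPrime f)

  φForest : Forest → Forest
  φForest []           = []
  φForest (node c ∷ f) = φPrime c ∷ φForest f

replicate-∷ʳ : ∀ m (x : Step) → replicate (suc m) x ≡ replicate m x ∷ʳ x
replicate-∷ʳ zero    x = refl
replicate-∷ʳ (suc m) x = cong (x ∷_) (replicate-∷ʳ m x)

mutual
  φF≡toWordF∘φForest : ∀ f → φF f ≡ toWordF (φForest f)
  φF≡toWordF∘φForest []           = refl
  φF≡toWordF∘φForest (node c ∷ f) = begin
    φInner c ++ (U ∷ D ∷ replicate (length c) D) ++ φF f
      ≡⟨ ++-assoc (φInner c) _ _ ⟨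
    (φInner c ++ U ∷ D ∷ replicate (length c) D) ++ φF f
      ≡⟨ cong₂ _++_ (φInner-peak≡toWordT∘φPrime c) (φF≡toWordF∘φForest f) ⟩
    toWordT (φPrime c) ++ toWordF (φForest f) ∎

  φInner-peak≡toWordT∘φPrime : ∀ c → φInner c ++ U ∷ D ∷ replicate (length c) D ≡ toWordT (φPrime c)
  φInner-peak≡toWordT∘φPrime []            = refl
  φInner-peak≡toWordT∘φPrime (node c ∷ f) = begin
    (U ∷ φF c ++ φInner f) ++ U ∷ D ∷ replicate (suc (length f)) D
      ≡⟨ cong (λ ds → (U ∷ φF c ++ φInner f) ++ U ∷ D ∷ ds) (replicate-∷ʳ (length f) D) ⟩
    (U ∷ φF c ++ φInner f) ++ (U ∷ D ∷ replicate (length f) D) ++ [ D ]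
      ≡⟨ cong (U ∷_) (++-assoc (φF c) (φInner f) _) ⟩
    U ∷ φF c ++ φInner f ++ (U ∷ D ∷ replicate (length f) D) ++ [ D ]
      ≡⟨ cong (λ w → U ∷ φF c ++ w) (++-assoc (φInner f) _ [ D ]) ⟨
    U ∷ φF c ++ (φInner f ++ U ∷ D ∷ replicate (length f) D) ++ [ D ]
      ≡⟨ cong₂ (λ w w′ → U ∷ w ++ w′ ++ [ D ]) (φF≡toWordF∘φForest c) (φInner-peak≡toWordT∘φPrime f) ⟩
    U ∷ toWordF (φForest c) ++ toWordT (φPrime f) ++ [ D ]
      ≡⟨ cong (U ∷_) (++-assoc (toWordF (φForest c)) (toWordT (φPrime f)) [ D ]) ⟨
    U ∷ (toWordF (φForest c) ++ toWordT (φPrime f)) ++ [ D ]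
      ≡⟨ cong (λ w → U ∷ w ++ [ D ]) (toWordF-∷ʳ (φForest c) (φPrime f)) ⟨
    toWordT (φPrime (node c ∷ f)) ∎

φ-toWordF : ∀ f → φ (toWordF f) ≡ toWordF (φForest f)
φ-toWordF f rewrite parse-toWordF f = φF≡toWordF∘φForest f

φneg-α-toWordF : ∀ f → φneg (α (toWordF f)) ≡ α (toWordF (φForest (βF f)))
φneg-α-toWordF f rewrite α-involutive (toWordF f) | parse-toWordF f = cong α (φF≡toWordF∘φForest (βF f))

[]≢∷ʳ : ∀ {A : Set} (xs : List A) {x} → [] ≢ xs ∷ʳ x
[]≢∷ʳ []      ()
[]≢∷ʳ (_ ∷ _) ()

node-injective : ∀ {c c′} → node c ≡ node c′ → c ≡ c′
node-injective refl = refl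

mutual
  φPrime-injective : ∀ {f f′} → φPrime f ≡ φPrime f′ → f ≡ f′
  φPrime-injective {[]}         {[]}           eq = refl
  φPrime-injective {[]}         {node c ∷ f}   eq = ⊥-elim ([]≢∷ʳ (φForest c) (node-injective eq))
  φPrime-injective {node c ∷ f} {[]}           eq = ⊥-elim ([]≢∷ʳ (φForest c) (sym (node-injective eq)))
  φPrime-injective {node c ∷ f} {node c′ ∷ f′} eq with ∷ʳ-injective (φForest c) (φForest c′) (node-injective eq)
  ... | eqc , eqf = cong₂ (λ c f → node c ∷ f) (φForest-injective eqc) (φPrime-injective eqf)

  φForest-injective : ∀ {f f′} → φForest f ≡ φForest f′ → f ≡ f′
  φForest-injective {[]}         {[]}           eq = refl
  φForest-injective {[]}         {node _ ∷ _}   ()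
  φForest-injective {node _ ∷ _} {[]}           ()
  φForest-injective {node c ∷ f} {node c′ ∷ f′} eq with ∷-injective eq
  ... | eqc , eqf = cong₂ (λ c f → node c ∷ f) (φPrime-injective eqc) (φForest-injective eqf)

φPrime⁻¹ : Tree → Set
φPrime⁻¹ t = ∃ λ f → φPrime f ≡ t

φForest-preimage : ∀ {f} → All φPrime⁻¹ f → ∃ λ f′ → φForest f′ ≡ f
φForest-preimage []                = [] , refl
φForest-preimage ((c , refl) ∷ ps) with φForest-preimage ps
... | f′ , refl = node c ∷ f′ , refl

node-preimage : ∀ ts → All φPrime⁻¹ ts → φPrime⁻¹ (node ts)
node-preimage ts ps with initLast ts
node-preimage .[]         ps | []        = [] , refl
node-preimage .(ts ∷ʳ t)  ps | ts ∷ʳ′ t with ∷ʳ⁻ ps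
... | pts , (f , refl) with φForest-preimage pts
...   | c , refl = node c ∷ f , refl

mutual
  φPrime-surjective : ∀ t → φPrime⁻¹ t
  φPrime-surjective (node ts) = node-preimage ts (φPrime-preimages ts)

  φPrime-preimages : ∀ ts → All φPrime⁻¹ ts
  φPrime-preimages []       = []
  φPrime-preimages (t ∷ ts) = φPrime-surjective t ∷ φPrime-preimages ts

φForest-surjective : ∀ f → ∃ λ f′ → φForest f′ ≡ f
φForest-surjective f = φForest-preimage (φPrime-preimages f)

mutual
  sizeᵗ : Tree → ℕ
  sizeᵗ (node c) = suc (size c)

  size : Forest → ℕ
  size []      = 0
  size (t ∷ f) = sizeᵗ t + size f

size-∷ʳ : ∀ f t → size (f ∷ʳ t) ≡ size f + sizeᵗ t
size-∷ʳ []       t = +-identityʳ (sizeᵗ t)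
size-∷ʳ (t′ ∷ f) t = trans (cong (sizeᵗ t′ +_) (size-∷ʳ f t)) (sym (+-assoc (sizeᵗ t′) (size f) (sizeᵗ t)))

mutual
  size-φPrime : ∀ f → sizeᵗ (φPrime f) ≡ suc (size f)
  size-φPrime []           = refl
  size-φPrime (node c ∷ f) = cong suc (begin
    size (φForest c ∷ʳ φPrime f)          ≡⟨ size-∷ʳ (φForest c) (φPrime f) ⟩
    size (φForest c) + sizeᵗ (φPrime f)   ≡⟨ cong₂ _+_ (size-φForest c) (size-φPrime f) ⟩
    size c + suc (size f)                 ≡⟨ +-suc (size c) (size f) ⟩
    suc (size c + size f)                 ∎)

  size-φForest : ∀ f → size (φForest f) ≡ size f
  size-φForest []           = refl
  size-φForest (node c ∷ f) = cong₂ _+_ (size-φPrime c) (size-φForest f)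

countU-++ : ∀ x y → countU (x ++ y) ≡ countU x + countU y
countU-++ []      y = refl
countU-++ (U ∷ x) y = cong suc (countU-++ x y)
countU-++ (D ∷ x) y = countU-++ x y

countD-++ : ∀ x y → countD (x ++ y) ≡ countD x + countD y
countD-++ []      y = refl
countD-++ (U ∷ x) y = countD-++ x y
countD-++ (D ∷ x) y = cong suc (countD-++ x y)

countU-toWordF : ∀ f → countU (toWordF f) ≡ size f
countU-toWordF []           = refl
countU-toWordF (node c ∷ f) = begin
  countU (toWordT (node c) ++ toWordF f)              ≡⟨ countU-++ (toWordT (node c)) (toWordF f) ⟩
  suc (countU (toWordF c ++ [ D ])) + countU (toWordF f)
    ≡⟨ cong (λ n → suc n + countU (toWordF f)) (trans (countU-++ (toWordF c) [ D ]) (+-identityʳ _)) ⟩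
  suc (countU (toWordF c)) + countU (toWordF f)      ≡⟨ cong₂ (λ m n → suc m + n) (countU-toWordF c) (countU-toWordF f) ⟩
  suc (size c) + size f                              ∎

countD-toWordF : ∀ f → countD (toWordF f) ≡ size f
countD-toWordF []           = refl
countD-toWordF (node c ∷ f) = begin
  countD (toWordT (node c) ++ toWordF f)              ≡⟨ countD-++ (toWordT (node c)) (toWordF f) ⟩
  countD (toWordF c ++ [ D ]) + countD (toWordF f)
    ≡⟨ cong (_+ countD (toWordF f)) (trans (countD-++ (toWordF c) [ D ]) (+-comm _ 1)) ⟩
  suc (countD (toWordF c)) + countD (toWordF f)      ≡⟨ cong₂ (λ m n → suc m + n) (countD-toWordF c) (countD-toWordF f) ⟩
  suc (size c) + size f                              ∎

oddUpsᶠ : Bool → Forest → ℕ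
oddUpsᶠ b []           = 0
oddUpsᶠ b (node c ∷ f) = (if not b then 1 else 0) + oddUpsᶠ (not b) c + oddUpsᶠ b f

-- leaves f is the number of peaks of toWordF f and valleysᵗ t the number of valleys of toWordT t;
-- a tree has one leaf more than valleys.
mutual
  valleysᵗ : Tree → ℕ
  valleysᵗ (node [])      = 0
  valleysᵗ (node (t ∷ f)) = valleysᵗ t + leaves f

  leaves : Forest → ℕ
  leaves []      = 0
  leaves (t ∷ f) = suc (valleysᵗ t + leaves f)

oddUpsᵖ-toWordF-++ : ∀ b f y → oddUpsᵖ b (toWordF f ++ y) ≡ oddUpsᶠ b f + oddUpsᵖ b y
oddUpsᵖ-toWordF-++ b []           y = refl
oddUpsᵖ-toWordF-++ b (node c ∷ f) y = begin
  oddUpsᵖ b (toWordF (node c ∷ f) ++ y)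
    ≡⟨ cong (oddUpsᵖ b) (onSide-toWordF-∷-++ above c f y) ⟩
  i + oddUpsᵖ (not b) (toWordF c ++ D ∷ toWordF f ++ y)
    ≡⟨ cong (i +_) (oddUpsᵖ-toWordF-++ (not b) c _) ⟩
  i + (oddUpsᶠ (not b) c + oddUpsᵖ (not (not b)) (toWordF f ++ y))
    ≡⟨ cong (λ b′ → i + (oddUpsᶠ (not b) c + oddUpsᵖ b′ (toWordF f ++ y))) (not-involutive b) ⟩
  i + (oddUpsᶠ (not b) c + oddUpsᵖ b (toWordF f ++ y))
    ≡⟨ cong (λ n → i + (oddUpsᶠ (not b) c + n)) (oddUpsᵖ-toWordF-++ b f y) ⟩
  i + (oddUpsᶠ (not b) c + (oddUpsᶠ b f + oddUpsᵖ b y))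
    ≡⟨ reassociate i (oddUpsᶠ (not b) c) (oddUpsᶠ b f) (oddUpsᵖ b y) ⟩
  i + oddUpsᶠ (not b) c + oddUpsᶠ b f + oddUpsᵖ b y ∎
  where
  i = if not b then 1 else 0
  reassociate : ∀ a m n k → a + (m + (n + k)) ≡ a + m + n + k
  reassociate = solve-∀

oddUpsᵖ-α-toWordF-++ : ∀ b f y → oddUpsᵖ b (α (toWordF f) ++ y) ≡ oddUpsᶠ (not b) f + oddUpsᵖ b y
oddUpsᵖ-α-toWordF-++ b []           y = refl
oddUpsᵖ-α-toWordF-++ b (node c ∷ f) y = begin
  oddUpsᵖ b (α (toWordF (node c ∷ f)) ++ y)
    ≡⟨ cong (oddUpsᵖ b) (onSide-toWordF-∷-++ below c f y) ⟩
  oddUpsᵖ (not b) (α (toWordF c) ++ U ∷ α (toWordF f) ++ y)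
    ≡⟨ oddUpsᵖ-α-toWordF-++ (not b) c _ ⟩
  oddUpsᶠ (not (not b)) c + ((if not (not b) then 1 else 0) + oddUpsᵖ (not (not b)) (α (toWordF f) ++ y))
    ≡⟨ cong (λ b′ → oddUpsᶠ b′ c + ((if b′ then 1 else 0) + oddUpsᵖ b′ (α (toWordF f) ++ y))) (not-involutive b) ⟩
  oddUpsᶠ b c + ((if b then 1 else 0) + oddUpsᵖ b (α (toWordF f) ++ y))
    ≡⟨ cong (λ n → oddUpsᶠ b c + ((if b then 1 else 0) + n)) (oddUpsᵖ-α-toWordF-++ b f y) ⟩
  oddUpsᶠ b c + ((if b then 1 else 0) + (oddUpsᶠ (not b) f + oddUpsᵖ b y))
    ≡⟨ rearrange (oddUpsᶠ b c) (if b then 1 else 0) (oddUpsᶠ (not b) f) (oddUpsᵖ b y) ⟩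
  (if b then 1 else 0) + oddUpsᶠ b c + oddUpsᶠ (not b) f + oddUpsᵖ b y
    ≡⟨ cong (λ b′ → (if b′ then 1 else 0) + oddUpsᶠ b′ c + oddUpsᶠ (not b) f + oddUpsᵖ b y) (not-involutive b) ⟨
  oddUpsᶠ (not b) (node c ∷ f) + oddUpsᵖ b y ∎
  where
  rearrange : ∀ m a n k → m + (a + (n + k)) ≡ a + m + n + k
  rearrange = solve-∀

mutual
  peaks-toWordT-++ : ∀ t y → peaks (toWordT t ++ y) ≡ suc (valleysᵗ t + peaks y)
  peaks-toWordT-++ (node [])           y = refl
  peaks-toWordT-++ (node (node c ∷ f)) y = begin
    peaks (toWordT (node (node c ∷ f)) ++ y)
      ≡⟨ cong peaks (toWordT-++ (node c ∷ f) y) ⟩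
    peaks ((toWordT (node c) ++ toWordF f) ++ D ∷ y)
      ≡⟨ cong peaks (++-assoc (toWordT (node c)) (toWordF f) (D ∷ y)) ⟩
    peaks (toWordT (node c) ++ toWordF f ++ D ∷ y)
      ≡⟨ peaks-toWordT-++ (node c) _ ⟩
    suc (valleysᵗ (node c) + peaks (toWordF f ++ D ∷ y))
      ≡⟨ cong (λ n → suc (valleysᵗ (node c) + n)) (peaks-toWordF-++ f (D ∷ y)) ⟩
    suc (valleysᵗ (node c) + (leaves f + peaks y))
      ≡⟨ cong suc (+-assoc (valleysᵗ (node c)) (leaves f) (peaks y)) ⟨
    suc (valleysᵗ (node (node c ∷ f)) + peaks y) ∎

  peaks-toWordF-++ : ∀ f y → peaks (toWordF f ++ y) ≡ leaves f + peaks y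
  peaks-toWordF-++ []      y = refl
  peaks-toWordF-++ (t ∷ f) y = begin
    peaks ((toWordT t ++ toWordF f) ++ y)   ≡⟨ cong peaks (++-assoc (toWordT t) (toWordF f) y) ⟩
    peaks (toWordT t ++ toWordF f ++ y)     ≡⟨ peaks-toWordT-++ t _ ⟩
    suc (valleysᵗ t + peaks (toWordF f ++ y)) ≡⟨ cong (λ n → suc (valleysᵗ t + n)) (peaks-toWordF-++ f y) ⟩
    suc (valleysᵗ t + (leaves f + peaks y)) ≡⟨ cong suc (+-assoc (valleysᵗ t) (leaves f) (peaks y)) ⟨
    leaves (t ∷ f) + peaks y                ∎

-- The peaks of a reflected forest word are the valleys of the forest word; NoLeadingD y rules out an
-- extra peak where the reflected word meets y.
mutual
  peaks-α-toWordF-++ : ∀ t f {y} → NoLeadingD y → peaks (α (toWordF (t ∷ f)) ++ y) ≡ valleysᵗ t + leaves f + peaks y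
  peaks-α-toWordF-++ (node []) f {y} ny = begin
    peaks (α (toWordF (node [] ∷ f)) ++ y)  ≡⟨ cong peaks (onSide-toWordF-∷-++ below [] f y) ⟩
    peaks (U ∷ α (toWordF f) ++ y)          ≡⟨ peaks-U∷α-toWordF-++ f ny ⟩
    leaves f + peaks y                      ∎
  peaks-α-toWordF-++ (node (t ∷ c)) f {y} ny = begin
    peaks (α (toWordF (node (t ∷ c) ∷ f)) ++ y)
      ≡⟨ cong peaks (onSide-toWordF-∷-++ below (t ∷ c) f y) ⟩
    peaks (α (toWordF (t ∷ c)) ++ U ∷ α (toWordF f) ++ y)
      ≡⟨ peaks-α-toWordF-++ t c (U∷ _) ⟩
    valleysᵗ t + leaves c + peaks (U ∷ α (toWordF f) ++ y)
      ≡⟨ cong (valleysᵗ t + leaves c +_) (peaks-U∷α-toWordF-++ f ny) ⟩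
    valleysᵗ t + leaves c + (leaves f + peaks y)
      ≡⟨ +-assoc (valleysᵗ t + leaves c) (leaves f) (peaks y) ⟨
    valleysᵗ (node (t ∷ c)) + leaves f + peaks y ∎

  peaks-U∷α-toWordF-++ : ∀ f {y} → NoLeadingD y → peaks (U ∷ α (toWordF f) ++ y) ≡ leaves f + peaks y
  peaks-U∷α-toWordF-++ []           ny = peaks-U∷ ny
  peaks-U∷α-toWordF-++ (node c ∷ f) ny = cong suc (peaks-α-toWordF-++ (node c) f ny)

leaves-∷ʳ : ∀ f t → leaves (f ∷ʳ t) ≡ leaves f + suc (valleysᵗ t)
leaves-∷ʳ []       t = cong suc (+-identityʳ (valleysᵗ t))
leaves-∷ʳ (t′ ∷ f) t = cong suc (trans (cong (valleysᵗ t′ +_) (leaves-∷ʳ f t)) (sym (+-assoc (valleysᵗ t′) (leaves f) _)))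

valleysᵗ-∷ʳ : ∀ f t → valleysᵗ (node (f ∷ʳ t)) ≡ leaves f + valleysᵗ t
valleysᵗ-∷ʳ []       t = +-identityʳ (valleysᵗ t)
valleysᵗ-∷ʳ (t′ ∷ f) t = begin
  valleysᵗ t′ + leaves (f ∷ʳ t)          ≡⟨ cong (valleysᵗ t′ +_) (leaves-∷ʳ f t) ⟩
  valleysᵗ t′ + (leaves f + suc (valleysᵗ t)) ≡⟨ rearrange (valleysᵗ t′) (leaves f) (valleysᵗ t) ⟩
  suc (valleysᵗ t′ + leaves f) + valleysᵗ t   ∎
  where
  rearrange : ∀ m n k → m + (n + suc k) ≡ suc (m + n) + k
  rearrange = solve-∀

mutual
  valleysᵗ-φPrime : ∀ f → valleysᵗ (φPrime f) ≡ oddUpsᶠ true f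
  valleysᵗ-φPrime []           = refl
  valleysᵗ-φPrime (node c ∷ f) = begin
    valleysᵗ (node (φForest c ∷ʳ φPrime f))      ≡⟨ valleysᵗ-∷ʳ (φForest c) (φPrime f) ⟩
    leaves (φForest c) + valleysᵗ (φPrime f)     ≡⟨ cong₂ _+_ (leaves-φForest c) (valleysᵗ-φPrime f) ⟩
    oddUpsᶠ false c + oddUpsᶠ true f             ∎

  leaves-φForest : ∀ f → leaves (φForest f) ≡ oddUpsᶠ false f
  leaves-φForest []           = refl
  leaves-φForest (node c ∷ f) = cong suc (cong₂ _+_ (valleysᵗ-φPrime c) (leaves-φForest f))

-- Bilateral Dyck words as sequences of blocks

-- A block is a nonempty forest, drawn above or below the x-axis.
Block : Set
Block = List⁺ Tree

blockWords : Side → List Block → List Word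
blockWords s []       = []
blockWords s (g ∷ gs) = onSide s (toWordF (toList g)) ∷ blockWords (opposite s) gs

blocksWord : Side → List Block → Word
blocksWord s gs = concat (blockWords s gs)

primeWord : Side → Tree → Word
primeWord s t = onSide s (toWordT t)

primesGo-up : ∀ s d acc w → primesGo (up s) (suc d) acc (up s ∷ w) ≡ primesGo (up s) (suc (suc d)) (up s ∷ acc) w
primesGo-up above d acc w = refl
primesGo-up below d acc w = refl

primesGo-down : ∀ s d acc w → primesGo (up s) (suc d) acc (down s ∷ w) ≡ primesGo (up s) d (down s ∷ acc) w
primesGo-down above d acc w = refl
primesGo-down below d acc w = refl

primesGo-onSide-toWordF-++ : ∀ s d acc f w →
  primesGo (up s) (suc d) acc (onSide s (toWordF f) ++ w) ≡ primesGo (up s) (suc d) (onSide s (toWordF f) ʳ++ acc) w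
primesGo-onSide-toWordF-++ above d acc []           w = refl
primesGo-onSide-toWordF-++ below d acc []           w = refl
primesGo-onSide-toWordF-++ s     d acc (node c ∷ f) w = begin
  primesGo (up s) (suc d) acc (onSide s (toWordF (node c ∷ f)) ++ w)
    ≡⟨ cong (primesGo (up s) (suc d) acc) (onSide-toWordF-∷-++ s c f w) ⟩
  primesGo (up s) (suc d) acc (up s ∷ X ++ down s ∷ Y ++ w)
    ≡⟨ primesGo-up s d acc _ ⟩
  primesGo (up s) (suc (suc d)) (up s ∷ acc) (X ++ down s ∷ Y ++ w)
    ≡⟨ primesGo-onSide-toWordF-++ s (suc d) (up s ∷ acc) c _ ⟩
  primesGo (up s) (suc (suc d)) (X ʳ++ up s ∷ acc) (down s ∷ Y ++ w)
    ≡⟨ primesGo-down s (suc d) _ _ ⟩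
  primesGo (up s) (suc d) (down s ∷ X ʳ++ up s ∷ acc) (Y ++ w)
    ≡⟨ primesGo-onSide-toWordF-++ s d _ f w ⟩
  primesGo (up s) (suc d) (Y ʳ++ down s ∷ X ʳ++ up s ∷ acc) w
    ≡⟨ cong (λ acc′ → primesGo (up s) (suc d) acc′ w) reversed ⟨
  primesGo (up s) (suc d) (onSide s (toWordF (node c ∷ f)) ʳ++ acc) w ∎
  where
  X = onSide s (toWordF c)
  Y = onSide s (toWordF f)
  reversed : onSide s (toWordF (node c ∷ f)) ʳ++ acc ≡ Y ʳ++ down s ∷ X ʳ++ up s ∷ acc
  reversed = trans (cong (_ʳ++ acc) (onSide-toWordF-∷ s c f)) (++-ʳ++ X)

primes-primeWord-++ : ∀ s t w → primes (primeWord s t ++ w) ≡ primeWord s t ∷ primes w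
primes-primeWord-++ s (node c) w = begin
  primes (primeWord s (node c) ++ w)
    ≡⟨ cong primes (onSide-toWordT-++ s c w) ⟩
  primesGo (up s) 1 [ up s ] (X ++ down s ∷ w)
    ≡⟨ primesGo-onSide-toWordF-++ s 0 [ up s ] c (down s ∷ w) ⟩
  primesGo (up s) 1 (X ʳ++ [ up s ]) (down s ∷ w)
    ≡⟨ primesGo-down s 0 _ w ⟩
  reverse (down s ∷ X ʳ++ [ up s ]) ∷ primes w
    ≡⟨ cong (λ p → reverse p ∷ primes w) (++-ʳ++ X) ⟨
  reverse (reverse (up s ∷ X ++ [ down s ])) ∷ primes w
    ≡⟨ cong (_∷ primes w) (trans (reverse-involutive _) (sym (onSide-toWordT s c))) ⟩
  primeWord s (node c) ∷ primes w ∎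
  where
  X = onSide s (toWordF c)

primes-onSide-toWordF-++ : ∀ s f w → primes (onSide s (toWordF f) ++ w) ≡ map (primeWord s) f ++ primes w
primes-onSide-toWordF-++ above []      w = refl
primes-onSide-toWordF-++ below []      w = refl
primes-onSide-toWordF-++ s     (t ∷ f) w = begin
  primes (onSide s (toWordT t ++ toWordF f) ++ w)
    ≡⟨ cong (λ x → primes (x ++ w)) (onSide-++ s (toWordT t) (toWordF f)) ⟩
  primes ((primeWord s t ++ onSide s (toWordF f)) ++ w)
    ≡⟨ cong primes (++-assoc (primeWord s t) (onSide s (toWordF f)) w) ⟩
  primes (primeWord s t ++ onSide s (toWordF f) ++ w)
    ≡⟨ primes-primeWord-++ s t _ ⟩
  primeWord s t ∷ primes (onSide s (toWordF f) ++ w)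
    ≡⟨ cong (primeWord s t ∷_) (primes-onSide-toWordF-++ s f w) ⟩
  primeWord s t ∷ map (primeWord s) f ++ primes w ∎

sameSide-same : ∀ s t g → sameSide (primeWord s t) (onSide s (toWordF (toList g))) ≡ true
sameSide-same above (node _) (node _ ∷ _) = refl
sameSide-same below (node _) (node _ ∷ _) = refl

sameSide-opposite : ∀ s t g → sameSide (primeWord s t) (onSide (opposite s) (toWordF (toList g))) ≡ false
sameSide-opposite above (node _) (node _ ∷ _) = refl
sameSide-opposite below (node _) (node _ ∷ _) = refl

primeWord≡blockWord : ∀ s t → primeWord s t ≡ onSide s (toWordF [ t ])
primeWord≡blockWord s t = cong (onSide s) (sym (++-identityʳ (toWordT t)))

groupBlocks-prepend : ∀ s t ts gs R → groupBlocks R ≡ blockWords (opposite s) gs →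
  groupBlocks (map (primeWord s) (t ∷ ts) ++ R) ≡ blockWords s ((t ∷ ts) ∷ gs)
groupBlocks-prepend s t [] []       []      _  = cong [_] (primeWord≡blockWord s t)
groupBlocks-prepend s t [] (_ ∷ _)  []      ()
groupBlocks-prepend s t [] []       (q ∷ R) eq with groupBlocks (q ∷ R) | eq
... | [] | _ = cong [_] (primeWord≡blockWord s t)
groupBlocks-prepend s t [] (g ∷ gs) (q ∷ R) eq with groupBlocks (q ∷ R) | eq
... | _ | refl rewrite sameSide-opposite s t g =
  cong (_∷ blockWords (opposite s) (g ∷ gs)) (primeWord≡blockWord s t)
groupBlocks-prepend s t (t′ ∷ ts) gs R eq
  rewrite groupBlocks-prepend s t′ ts gs R eq | sameSide-same s t (t′ ∷ ts) =
  cong (_∷ blockWords (opposite s) gs) (sym (onSide-++ s (toWordT t) (toWordF (t′ ∷ ts))))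

blocks-blocksWord : ∀ s gs → blocks (blocksWord s gs) ≡ blockWords s gs
blocks-blocksWord s []              = refl
blocks-blocksWord s ((t ∷ ts) ∷ gs) = begin
  groupBlocks (primes (onSide s (toWordF (t ∷ ts)) ++ blocksWord (opposite s) gs))
    ≡⟨ cong groupBlocks (primes-onSide-toWordF-++ s (t ∷ ts) _) ⟩
  groupBlocks (map (primeWord s) (t ∷ ts) ++ primes (blocksWord (opposite s) gs))
    ≡⟨ groupBlocks-prepend s t ts gs _ (blocks-blocksWord (opposite s) gs) ⟩
  blockWords s ((t ∷ ts) ∷ gs) ∎

-- Below the axis φ' acts as φ ∘ β, and β exchanges the children of the first root with the other trees.
φBlock : Side → Block → Block
φBlock above (node c ∷ f) = φPrime c ∷ φForest f
φBlock below (node c ∷ f) = φPrime f ∷ φForest c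

φBlocks : Side → List Block → List Block
φBlocks s []       = []
φBlocks s (g ∷ gs) = φBlock s g ∷ φBlocks (opposite s) gs

φ'block-onSide : ∀ s g → φ'block (onSide s (toWordF (toList g))) ≡ onSide s (toWordF (toList (φBlock s g)))
φ'block-onSide above (node c ∷ f) = φ-toWordF (node c ∷ f)
φ'block-onSide below (node c ∷ f) = φneg-α-toWordF (node c ∷ f)

concatMapW-φ'block : ∀ s gs → concatMapW φ'block (blockWords s gs) ≡ blocksWord s (φBlocks s gs)
concatMapW-φ'block s []       = refl
concatMapW-φ'block s (g ∷ gs) = cong₂ _++_ (φ'block-onSide s g) (concatMapW-φ'block (opposite s) gs)

φ'-blocksWord : ∀ s gs → φ' (blocksWord s gs) ≡ blocksWord s (φBlocks s gs)
φ'-blocksWord s gs = trans (cong (concatMapW φ'block) (blocks-blocksWord s gs)) (concatMapW-φ'block s gs)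

onSide-toWordF-injective : ∀ s s′ g g′ →
  onSide s (toWordF (toList g)) ≡ onSide s′ (toWordF (toList g′)) → s ≡ s′ × g ≡ g′
onSide-toWordF-injective above above (t ∷ f) (t′ ∷ f′) eq with toWordF-injective {t ∷ f} {t′ ∷ f′} eq
... | refl = refl , refl
onSide-toWordF-injective below below (t ∷ f) (t′ ∷ f′) eq with toWordF-injective {t ∷ f} {t′ ∷ f′} (α-injective eq)
... | refl = refl , refl
onSide-toWordF-injective above below (node _ ∷ _) (node _ ∷ _) ()
onSide-toWordF-injective below above (node _ ∷ _) (node _ ∷ _) ()

-- The side of an empty sequence of blocks is arbitrary.
blockWords-injective : ∀ s s′ gs gs′ → blockWords s gs ≡ blockWords s′ gs′ → gs ≡ gs′ × (gs ≡ [] ⊎ s ≡ s′)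
blockWords-injective s s′ []       []         _  = refl , inj₁ refl
blockWords-injective s s′ (g ∷ gs) (g′ ∷ gs′) eq with ∷-injective eq
... | eq-g , eq-gs with onSide-toWordF-injective s s′ g g′ eq-g
...   | refl , refl with blockWords-injective (opposite s) (opposite s) gs gs′ eq-gs
...     | refl , _ = refl , inj₂ refl

blocksWord-injective : ∀ s s′ gs gs′ → blocksWord s gs ≡ blocksWord s′ gs′ → gs ≡ gs′ × (gs ≡ [] ⊎ s ≡ s′)
blocksWord-injective s s′ gs gs′ eq = blockWords-injective s s′ gs gs′
  (trans (sym (blocks-blocksWord s gs)) (trans (cong blocks eq) (blocks-blocksWord s′ gs′)))

φBlock-injective : ∀ s {g g′} → φBlock s g ≡ φBlock s g′ → g ≡ g′
φBlock-injective above {node c ∷ f} {node c′ ∷ f′} eq =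
  cong₂ (λ c f → node c ∷ f) (φPrime-injective (cong List⁺.head eq)) (φForest-injective (cong List⁺.tail eq))
φBlock-injective below {node c ∷ f} {node c′ ∷ f′} eq =
  cong₂ (λ c f → node c ∷ f) (φForest-injective (cong List⁺.tail eq)) (φPrime-injective (cong List⁺.head eq))

φBlocks-injective : ∀ s {gs gs′} → φBlocks s gs ≡ φBlocks s gs′ → gs ≡ gs′
φBlocks-injective s {[]}     {[]}       eq = refl
φBlocks-injective s {g ∷ gs} {g′ ∷ gs′} eq =
  cong₂ _∷_ (φBlock-injective s (∷-injectiveˡ eq)) (φBlocks-injective (opposite s) (∷-injectiveʳ eq))

φBlock-surjective : ∀ s g → ∃ λ g′ → φBlock s g′ ≡ g
φBlock-surjective above (t ∷ f) with φPrime-surjective t | φForest-surjective f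
... | c , refl | f′ , refl = node c ∷ f′ , refl
φBlock-surjective below (t ∷ f) with φPrime-surjective t | φForest-surjective f
... | f′ , refl | c , refl = node c ∷ f′ , refl

φBlocks-surjective : ∀ s gs → ∃ λ gs′ → φBlocks s gs′ ≡ gs
φBlocks-surjective s []       = [] , refl
φBlocks-surjective s (g ∷ gs) with φBlock-surjective s g | φBlocks-surjective (opposite s) gs
... | g′ , refl | gs′ , refl = g′ ∷ gs′ , refl

totalSize : List Block → ℕ
totalSize []       = 0
totalSize (g ∷ gs) = size (toList g) + totalSize gs

size-φBlock : ∀ s g → size (toList (φBlock s g)) ≡ size (toList g)
size-φBlock above (node c ∷ f) = cong₂ _+_ (size-φPrime c) (size-φForest f)
size-φBlock below (node c ∷ f) = trans (cong₂ _+_ (size-φPrime f) (size-φForest c)) (cong suc (+-comm (size f) (size c)))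

totalSize-φBlocks : ∀ s gs → totalSize (φBlocks s gs) ≡ totalSize gs
totalSize-φBlocks s []       = refl
totalSize-φBlocks s (g ∷ gs) = cong₂ _+_ (size-φBlock s g) (totalSize-φBlocks (opposite s) gs)

countU-blocksWord : ∀ s gs → countU (blocksWord s gs) ≡ totalSize gs
countU-blocksWord s        []       = refl
countU-blocksWord s        (g ∷ gs) = trans (countU-++ (onSide s (toWordF (toList g))) _)
  (cong₂ _+_ (countU-onSide s) (countU-blocksWord (opposite s) gs))
  where
  countU-onSide : ∀ s → countU (onSide s (toWordF (toList g))) ≡ size (toList g)
  countU-onSide above = countU-toWordF (toList g)
  countU-onSide below = trans (countU-α (toWordF (toList g))) (countD-toWordF (toList g))

countD-blocksWord : ∀ s gs → countD (blocksWord s gs) ≡ totalSize gs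
countD-blocksWord s        []       = refl
countD-blocksWord s        (g ∷ gs) = trans (countD-++ (onSide s (toWordF (toList g))) _)
  (cong₂ _+_ (countD-onSide s) (countD-blocksWord (opposite s) gs))
  where
  countD-onSide : ∀ s → countD (onSide s (toWordF (toList g))) ≡ size (toList g)
  countD-onSide above = countD-toWordF (toList g)
  countD-onSide below = trans (countD-α (toWordF (toList g))) (countU-toWordF (toList g))

BilateralDyck-blocksWord : ∀ n s gs → BilateralDyck n (blocksWord s gs) ⇔ (totalSize gs ≡ n)
BilateralDyck-blocksWord n s gs = mk⇔
  (λ (eqU , _) → trans (sym (countU-blocksWord s gs)) eqU)
  (λ eq → trans (countU-blocksWord s gs) eq , trans (countD-blocksWord s gs) eq)

BilateralDyck-φBlocks : ∀ n s gs → BilateralDyck n (blocksWord s (φBlocks s gs)) ⇔ BilateralDyck n (blocksWord s gs)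
BilateralDyck-φBlocks n s gs =
  ⇔-trans (BilateralDyck-blocksWord n s (φBlocks s gs))
    (⇔-trans (mk⇔ (trans (sym size-eq)) (trans size-eq)) (⇔-sym (BilateralDyck-blocksWord n s gs)))
  where
  size-eq = totalSize-φBlocks s gs

noLeadingD-blocksWord-above : ∀ gs → NoLeadingD (blocksWord above gs)
noLeadingD-blocksWord-above []                  = []
noLeadingD-blocksWord-above ((node _ ∷ _) ∷ _) = U∷ _

-- Every block starts on the x-axis, at even height.
peaks-φBlocks : ∀ s gs → peaks (blocksWord s (φBlocks s gs)) ≡ oddUpsᵖ false (blocksWord s gs)
peaks-φBlocks s     []                  = refl
peaks-φBlocks above ((node c ∷ f) ∷ gs) = begin
  peaks (toWordF (φForest (node c ∷ f)) ++ blocksWord below (φBlocks below gs))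
    ≡⟨ peaks-toWordF-++ (φForest (node c ∷ f)) _ ⟩
  leaves (φForest (node c ∷ f)) + peaks (blocksWord below (φBlocks below gs))
    ≡⟨ cong₂ _+_ (leaves-φForest (node c ∷ f)) (peaks-φBlocks below gs) ⟩
  oddUpsᶠ false (node c ∷ f) + oddUpsᵖ false (blocksWord below gs)
    ≡⟨ oddUpsᵖ-toWordF-++ false (node c ∷ f) _ ⟨
  oddUpsᵖ false (toWordF (node c ∷ f) ++ blocksWord below gs) ∎
peaks-φBlocks below ((node c ∷ f) ∷ gs) = begin
  peaks (α (toWordF (φPrime f ∷ φForest c)) ++ blocksWord above (φBlocks above gs))
    ≡⟨ peaks-α-toWordF-++ (φPrime f) (φForest c) (noLeadingD-blocksWord-above (φBlocks above gs)) ⟩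
  valleysᵗ (φPrime f) + leaves (φForest c) + peaks (blocksWord above (φBlocks above gs))
    ≡⟨ cong₂ _+_ (cong₂ _+_ (valleysᵗ-φPrime f) (leaves-φForest c)) (peaks-φBlocks above gs) ⟩
  oddUpsᶠ true f + oddUpsᶠ false c + oddUpsᵖ false (blocksWord above gs)
    ≡⟨ cong (_+ oddUpsᵖ false (blocksWord above gs)) (+-comm (oddUpsᶠ true f) (oddUpsᶠ false c)) ⟩
  oddUpsᶠ true (node c ∷ f) + oddUpsᵖ false (blocksWord above gs)
    ≡⟨ oddUpsᵖ-α-toWordF-++ false (node c ∷ f) _ ⟨
  oddUpsᵖ false (α (toWordF (node c ∷ f)) ++ blocksWord above gs) ∎

descents : ∀ {k} → Vec Forest k → Word
descents []       = []
descents (f ∷ fs) = toWordF f ++ D ∷ descents fs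

-- A word with k + 1 more down-steps than up-steps reaches the heights -1, …, -(k+1) for the first
-- time by the down-steps after the forests f, f₁, …, fₖ.
split-descents : ∀ k w → countU w + suc k ≡ countD w →
  Σ Forest λ f → Σ (Vec Forest k) λ fs → Σ Word λ r →
    w ≡ toWordF f ++ D ∷ descents fs ++ r × Balanced r × length r ≤ length w
split-descents k       []      ()
split-descents zero    (D ∷ w) eq = [] , [] , w , refl , suc-injective (trans (+-comm 1 (countU w)) eq) , m≤n⇒m≤1+n ≤-refl
split-descents (suc k) (D ∷ w) eq with split-descents k w (suc-injective (trans (sym (+-suc (countU w) (suc k))) eq))
... | f , fs , r , refl , bal , r≤w =
  [] , f ∷ fs , r , cong (D ∷_) (sym (++-assoc (toWordF f) (D ∷ descents fs) r)) , bal , m≤n⇒m≤1+n r≤w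
split-descents k       (U ∷ w) eq with split-descents (suc k) w (trans (+-suc (countU w) (suc k)) eq)
... | c , f ∷ fs , r , refl , bal , r≤w = node c ∷ f , fs , r , unfold , bal , m≤n⇒m≤1+n r≤w
  where
  unfold : U ∷ toWordF c ++ D ∷ (toWordF f ++ D ∷ descents fs) ++ r ≡ toWordF (node c ∷ f) ++ D ∷ descents fs ++ r
  unfold = begin
    U ∷ toWordF c ++ D ∷ (toWordF f ++ D ∷ descents fs) ++ r
      ≡⟨ cong (λ w → U ∷ toWordF c ++ D ∷ w) (++-assoc (toWordF f) (D ∷ descents fs) r) ⟩
    U ∷ toWordF c ++ D ∷ toWordF f ++ D ∷ descents fs ++ r
      ≡⟨ onSide-toWordF-∷-++ above c f (D ∷ descents fs ++ r) ⟨
    toWordF (node c ∷ f) ++ D ∷ descents fs ++ r ∎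

first-prime-above : ∀ w → Balanced (U ∷ w) →
  Σ Forest λ c → Σ Word λ r → U ∷ w ≡ toWordT (node c) ++ r × Balanced r × length r ≤ length w
first-prime-above w bal with split-descents 0 w (trans (+-comm (countU w) 1) bal)
... | c , [] , r , refl , bal-r , r≤w = c , r , sym (toWordT-++ c r) , bal-r , r≤w

first-prime : ∀ x w → Balanced (x ∷ w) →
  Σ Side λ s → Σ Forest λ c → Σ Word λ r → x ∷ w ≡ primeWord s (node c) ++ r × Balanced r × length r ≤ length w
first-prime U w bal with first-prime-above w bal
... | c , r , eq , bal-r , r≤w = above , c , r , eq , bal-r , r≤w
first-prime D w bal with first-prime-above (α w) (Balanced-α (D ∷ w) bal)
... | c , r , eq , bal-r , r≤w = below , c , α r , reflected , Balanced-α r bal-r , length-α≤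
  where
  reflected : D ∷ w ≡ α (toWordT (node c)) ++ α r
  reflected = trans (sym (α-involutive (D ∷ w))) (trans (cong α eq) (α-++ (toWordT (node c)) r))
  length-α≤ : length (α r) ≤ length w
  length-α≤ = ≤-trans (≤-reflexive (length-α r)) (≤-trans r≤w (≤-reflexive (length-α w)))

onSide-toWordF-∷⁺-++ : ∀ s t g w → onSide s (toWordF (toList (t ∷⁺ g))) ++ w ≡ primeWord s t ++ onSide s (toWordF (toList g)) ++ w
onSide-toWordF-∷⁺-++ s t g w = trans (cong (_++ w) (onSide-++ s (toWordT t) _)) (++-assoc (primeWord s t) _ w)

prepend-prime : ∀ s t s′ gs → ∃₂ λ s″ gs″ → blocksWord s″ gs″ ≡ primeWord s t ++ blocksWord s′ gs
prepend-prime s     t s′    []       = s , [ t ∷ [] ] , cong (_++ []) (sym (primeWord≡blockWord s t))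
prepend-prime above t above (g ∷ gs) = above , (t ∷⁺ g) ∷ gs , onSide-toWordF-∷⁺-++ above t g _
prepend-prime below t below (g ∷ gs) = below , (t ∷⁺ g) ∷ gs , onSide-toWordF-∷⁺-++ below t g _
prepend-prime above t below (g ∷ gs) = above , (t ∷ []) ∷ g ∷ gs , cong (_++ _) (sym (primeWord≡blockWord above t))
prepend-prime below t above (g ∷ gs) = below , (t ∷ []) ∷ g ∷ gs , cong (_++ _) (sym (primeWord≡blockWord below t))

decompose : ∀ n w → length w ≤ n → Balanced w → ∃₂ λ s gs → blocksWord s gs ≡ w
decompose n       []      _         _   = above , [] , refl
decompose (suc n) (x ∷ w) (s≤s w≤n) bal with first-prime x w bal
... | s , c , r , eq , bal-r , r≤w with decompose n r (≤-trans r≤w w≤n) bal-r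
...   | s′ , gs , refl with prepend-prime s (node c) s′ gs
...     | s″ , gs″ , eq′ = s″ , gs″ , trans eq′ (sym eq)

blocksWord-surjective : ∀ w → Balanced w → ∃₂ λ s gs → blocksWord s gs ≡ w
blocksWord-surjective w = decompose (length w) w ≤-refl

BilateralDyck⇒Balanced : ∀ {n} w → BilateralDyck n w → Balanced w
BilateralDyck⇒Balanced _ (eqU , eqD) = trans eqU (sym eqD)

φ'-BilateralDyck : ∀ {n} w → BilateralDyck n w → BilateralDyck n (φ' w)
φ'-BilateralDyck {n} w bd with blocksWord-surjective w (BilateralDyck⇒Balanced w bd)
... | s , gs , refl rewrite φ'-blocksWord s gs = Equivalence.from (BilateralDyck-φBlocks n s gs) bd

peaks-φ' : ∀ w → Balanced w → peaks (φ' w) ≡ oddUps w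
peaks-φ' w bal with blocksWord-surjective w bal
... | s , gs , refl = begin
  peaks (φ' (blocksWord s gs))            ≡⟨ cong peaks (φ'-blocksWord s gs) ⟩
  peaks (blocksWord s (φBlocks s gs))     ≡⟨ peaks-φBlocks s gs ⟩
  oddUpsᵖ false (blocksWord s gs)         ≡⟨ oddUpsFrom≡oddUpsᵖ ℤ.0ℤ (blocksWord s gs) ⟨
  oddUps (blocksWord s gs)                ∎

φBlocks≡[] : ∀ s {gs} → φBlocks s gs ≡ [] → gs ≡ []
φBlocks≡[] s {[]} _ = refl

φ'-injective : ∀ w w′ → Balanced w → Balanced w′ → φ' w ≡ φ' w′ → w ≡ w′
φ'-injective w w′ bal bal′ eq with blocksWord-surjective w bal | blocksWord-surjective w′ bal′
... | s , gs , refl | s′ , gs′ , refl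
  with blocksWord-injective s s′ (φBlocks s gs) (φBlocks s′ gs′)
         (trans (sym (φ'-blocksWord s gs)) (trans eq (φ'-blocksWord s′ gs′)))
...   | same , inj₂ refl = cong (blocksWord s) (φBlocks-injective s same)
...   | same , inj₁ none with φBlocks≡[] s none | φBlocks≡[] s′ (trans (sym same) none)
...     | refl | refl = refl

φ'-surjective : ∀ {n} v → BilateralDyck n v → ∃ λ w → BilateralDyck n w × φ' w ≡ v
φ'-surjective {n} v bd with blocksWord-surjective v (BilateralDyck⇒Balanced v bd)
... | s , hs , refl with φBlocks-surjective s hs
...   | gs , refl = blocksWord s gs , Equivalence.to (BilateralDyck-φBlocks n s gs) bd , φ'-blocksWord s gs

theorem2 : (n k : ℕ) →
    ((w : Word) → BilateralDyck n w → oddUps w ≡ k →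
       BilateralDyck n (φ' w) × peaks (φ' w) ≡ k)
    × ((w w′ : Word) → BilateralDyck n w → oddUps w ≡ k →
         BilateralDyck n w′ → oddUps w′ ≡ k →
         φ' w ≡ φ' w′ → w ≡ w′)
    × ((v : Word) → BilateralDyck n v → peaks v ≡ k →
         Σ Word (λ w → BilateralDyck n w × oddUps w ≡ k × φ' w ≡ v))
theorem2 n k = maps-into , injective , surjective
  where
  maps-into : (w : Word) → BilateralDyck n w → oddUps w ≡ k → BilateralDyck n (φ' w) × peaks (φ' w) ≡ k
  maps-into w bd odd = φ'-BilateralDyck w bd , trans (peaks-φ' w (BilateralDyck⇒Balanced w bd)) odd

  injective : (w w′ : Word) → BilateralDyck n w → oddUps w ≡ k → BilateralDyck n w′ → oddUps w′ ≡ k →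
    φ' w ≡ φ' w′ → w ≡ w′
  injective w w′ bd _ bd′ _ = φ'-injective w w′ (BilateralDyck⇒Balanced w bd) (BilateralDyck⇒Balanced w′ bd′)

  surjective : (v : Word) → BilateralDyck n v → peaks v ≡ k →
    Σ Word (λ w → BilateralDyck n w × oddUps w ≡ k × φ' w ≡ v)
  surjective v bd pk with φ'-surjective v bd
  ... | w , bd-w , refl = w , bd-w , trans (sym (peaks-φ' w (BilateralDyck⇒Balanced w bd-w))) pk , refl
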